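{- Let $\Gamma$ be a group that is nilpotent of class $\le n$, let $S$ be a generating set of $\Gamma$ containing two inequivalent elements, let $G=\mathrm{Cay}(\Gamma,S)$ and let $r\ge 2^{n+1}$. Suppose that for all $g,h\in S$ with $g\not\equiv h$ there exists a morpheme of $\Gamma$ in $S$ of length at most $r$ that is magic in $g$ and $h$. Then $G$ has no $r$-local cutvertex.
   Context: Generating sets $S\subseteq\Gamma\setminus\{\mathbb{I}\}$ are closed under inverses; $\mathrm{Cay}(\Gamma,S)$ is the simple graph on $\Gamma$ with edges $\{g,gs\}$. $g\equiv h$ means $g=h$ or $g=h^{ -1}$. Nilpotency (paper's definition): with words $[g,h]_1:=gh^{ -1}g^{ -1}h$ and $[g,h]_n:=[g,[g,h]_{n-1}]_1$ (freely reduced), $\Gamma$ is nilpotent of class $\le n$ if $[g,h]_n=\mathbb{I}$ for all $g\not\equiv h$. A morpheme of $\Gamma$ in $S$ is a nonempty word in $S$ with product $\mathbb{I}$ such that no nonempty proper contiguous subword has product $\mathbb{I}$. A word $u$ is magic in $g$ and $h$ if $u$ and $u^{ -1}$ together contain at least three of $gh$, $hg$, $g^{ -1}h$, $hg^{ -1}$ as contiguous subwords. The ball $B_r(v)$ consists of all vertices and edges on closed walks of length $\le r$ through $v$; $v$ is an $r$-local cutvertex if $B_r(v)-v$ is disconnected. -}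

module Defs where

open import Level using (Level; _⊔_; Lift)
open import Algebra.Bundles using (Group)
open import Data.List using (List; []; _∷_; _++_; foldr; reverse; map; length)
open import Data.List.Relation.Unary.All using (All)
open import Data.Nat using (ℕ; zero; suc; _≤_)
open import Data.Fin using (Fin)
import Data.Fin as F
open import Data.Product using (Σ; ∃; _×_; _,_)
open import Data.Sum using (_⊎_)
open import Data.Empty using (⊥)
open import Relation.Nullary using (¬_)
open import Relation.Unary using (Pred)
open import Relation.Binary.PropositionalEquality using (_≡_; _≢_)

module Cay {c ℓ} (Γ : Group c ℓ) where
  open Group Γ

  _≡ᵍ_ : Carrier → Carrier → Set ℓ
  g ≡ᵍ h = (g ≈ h) ⊎ (g ≈ h ⁻¹)

  comm₁ : Carrier → Carrier → Carrier
  comm₁ g h = g ∙ (h ⁻¹ ∙ (g ⁻¹ ∙ h))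

  -- value in Γ of the word [g,h]ₙ  (bracket 0 g h = h, so bracket 1 = [g,h]₁);
  -- free reduction does not change the value of a word
  bracket : ℕ → Carrier → Carrier → Carrier
  bracket zero    g h = h
  bracket (suc n) g h = comm₁ g (bracket n g h)

  -- the paper's definition of "nilpotent of class ≤ n"
  NilpotentClass≤ : ℕ → Set (c ⊔ ℓ)
  NilpotentClass≤ n = ∀ g h → ¬ (g ≡ᵍ h) → bracket n g h ≈ ε

  prod : List Carrier → Carrier
  prod = foldr _∙_ ε

  invWord : List Carrier → List Carrier
  invWord u = reverse (map _⁻¹ u)

  module _ {p} (S : Pred Carrier p) where

    IsGeneratingSet : Set (c ⊔ ℓ ⊔ p)
    IsGeneratingSet =
      (∀ {x y} → x ≈ y → S x → S y) ×
      (¬ S ε) ×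
      (∀ {s} → S s → S (s ⁻¹)) ×
      (∀ x → Σ (List Carrier) λ w → All S w × prod w ≈ x)

    IsMorpheme : List Carrier → Set (c ⊔ ℓ ⊔ p)
    IsMorpheme w =
      All S w × w ≢ [] × prod w ≈ ε ×
      (∀ (pre m suf : List Carrier) → w ≡ pre ++ m ++ suf → m ≢ [] →
         (pre ≢ [] ⊎ suf ≢ []) → ¬ (prod m ≈ ε))

    Adj : Carrier → Carrier → Set (c ⊔ ℓ ⊔ p)
    Adj x y = Σ Carrier λ s → S s × y ≈ x ∙ s

    data Walk : Carrier → Carrier → Set (c ⊔ ℓ ⊔ p) where
      []  : ∀ {x y} → x ≈ y → Walk x y
      _∷_ : ∀ {x y z} → Adj x y → Walk y z → Walk x z

    len : ∀ {x y} → Walk x y → ℕ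
    len ([] _)  = 0
    len (_ ∷ w) = suc (len w)

    VertexOn : Carrier → ∀ {x y} → Walk x y → Set ℓ
    VertexOn a {x} ([] _) = a ≈ x
    VertexOn a {x} (_ ∷ w) = (a ≈ x) ⊎ VertexOn a w

    EdgeOn : Carrier → Carrier → ∀ {x y} → Walk x y → Set ℓ
    EdgeOn a b ([] _) = Lift ℓ ⊥
    EdgeOn a b (_∷_ {x} {y} _ w) =
      ((a ≈ x × b ≈ y) ⊎ (a ≈ y × b ≈ x)) ⊎ EdgeOn a b w

    -- vertices / edges of the ball B_r(v): those on closed walks of length ≤ r
    -- through v (w.l.o.g. starting and ending at v)
    InBall : ℕ → Carrier → Carrier → Set (c ⊔ ℓ ⊔ p)
    InBall r v a = Σ (Walk v v) λ w → len w ≤ r × VertexOn a w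

    EdgeInBall : ℕ → Carrier → Carrier → Carrier → Set (c ⊔ ℓ ⊔ p)
    EdgeInBall r v a b = Σ (Walk v v) λ w → len w ≤ r × EdgeOn a b w

    PunctEdge : ℕ → Carrier → Carrier → Carrier → Set (c ⊔ ℓ ⊔ p)
    PunctEdge r v a b = EdgeInBall r v a b × ¬ (a ≈ v) × ¬ (b ≈ v)

    data Reach (r : ℕ) (v : Carrier) : Carrier → Carrier → Set (c ⊔ ℓ ⊔ p) where
      here : ∀ {a b} → a ≈ b → Reach r v a b
      step : ∀ {a b d} → PunctEdge r v a d → Reach r v d b → Reach r v a b

    IsLocalCutvertex : ℕ → Carrier → Set (c ⊔ ℓ ⊔ p)
    IsLocalCutvertex r v =
      Σ Carrier λ a → Σ Carrier λ b →
        (InBall r v a × ¬ (a ≈ v)) × (InBall r v b × ¬ (b ≈ v)) × ¬ Reach r v a b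

  OccursIn : Carrier → Carrier → List Carrier → Set (c ⊔ ℓ)
  OccursIn x y u = Σ (List Carrier) λ pre → Σ Carrier λ a → Σ Carrier λ b →
    Σ (List Carrier) λ suf → (u ≡ pre ++ a ∷ b ∷ suf) × a ≈ x × b ≈ y

  Contains : Carrier → Carrier → List Carrier → Set (c ⊔ ℓ)
  Contains x y u = OccursIn x y u ⊎ OccursIn x y (invWord u)

  magicPattern : Carrier → Carrier → Fin 4 → Carrier × Carrier
  magicPattern g h F.zero = g , h
  magicPattern g h (F.suc F.zero) = h , g
  magicPattern g h (F.suc (F.suc F.zero)) = g ⁻¹ , h
  magicPattern g h (F.suc (F.suc (F.suc F.zero))) = h , g ⁻¹

  ContainsPattern : Carrier × Carrier → List Carrier → Set (c ⊔ ℓ)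
  ContainsPattern (x , y) u = Contains x y u

  IsMagic : Carrier → Carrier → List Carrier → Set (c ⊔ ℓ)
  IsMagic g h u = Σ (Fin 4) λ i → Σ (Fin 4) λ j → Σ (Fin 4) λ k →
    i ≢ j × i ≢ k × j ≢ k ×
    ContainsPattern (magicPattern g h i) u ×
    ContainsPattern (magicPattern g h j) u ×
    ContainsPattern (magicPattern g h k) u

-- Let w = pre a b suf be a morpheme of length ≤ r. Walking around its rotation
-- b suf pre a from v gives a closed walk of length ≤ r through v that returns
-- to v only at its end, because a proper arc of a cyclically read morpheme has
-- nontrivial product. Its middle part therefore joins v b to v a⁻¹ inside
-- B_r(v) - v. Read in w or in w⁻¹, the four patterns gh, hg, g⁻¹h, hg⁻¹ link
-- the neighbours v g, v h, v g⁻¹, v h⁻¹ along a 4-cycle, and any three of its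
-- edges connect all four. Fixing inequivalent generators g₀ and h₀, every
-- s ∈ S is thus linked to g₀ (through the morpheme for g₀ and h₀ when
-- s = g₀⁻¹), so all neighbours of v lie in one component of B_r(v) - v; every
-- other vertex of the ball reaches a neighbour of v along the closed walk
-- witnessing its membership.
{-# OPTIONS --safe #-}
module Submission where

open import Defs
open import Algebra.Bundles using (Group)
import Algebra.Properties.Group as GroupProperties
open import Data.Fin using (Fin; zero; suc)
open import Data.Fin.Properties using (_≟_; all?; any?)
open import Data.List using (List; []; _∷_; _++_; _∷ʳ_; [_]; length; map; reverse)
open import Data.List.Membership.Propositional using (_∈_)
open import Data.List.Membership.DecPropositional (_≟_ {4}) using (_∈?_)
open import Data.List.Properties
  using (∷-injective; ++-assoc; ++-conicalʳ; length-++-comm; reverse-++; reverse-involutive)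
open import Data.List.Relation.Unary.All using (All; []; _∷_; lookup)
open import Data.List.Relation.Unary.All.Properties using (++⁺; ++⁻; ++⁻ˡ)
open import Data.Nat using (ℕ; suc; _≤_; _^_)
open import Data.Product using (Σ; ∃-syntax; _×_; _,_; proj₁; proj₂)
open import Data.Sum using (_⊎_; inj₁; inj₂)
open import Level using (_⊔_; lift)
import Relation.Binary.PropositionalEquality as ≡
open ≡ using (_≡_; _≢_)
open import Relation.Nullary using (¬_; yes; no)
open import Relation.Nullary.Decidable using (from-yes; ¬?; _→-dec_; ¬¬-excluded-middle)
open import Relation.Unary using (Pred)

module _ {a} {A : Set a} where

  levi : ∀ (as bs cs ds : List A) → as ++ bs ≡ cs ++ ds →
         (∃[ t ] cs ≡ as ++ t × bs ≡ t ++ ds) ⊎ (∃[ t ] as ≡ cs ++ t × ds ≡ t ++ bs)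
  levi []       bs cs       ds eq = inj₁ (cs , ≡.refl , eq)
  levi (x ∷ as) bs []       ds eq = inj₂ (x ∷ as , ≡.refl , ≡.sym eq)
  levi (x ∷ as) bs (y ∷ cs) ds eq with ∷-injective eq
  ... | ≡.refl , eq′ with levi as bs cs ds eq′
  ...   | inj₁ (t , cs≡ , bs≡) = inj₁ (t , ≡.cong (x ∷_) cs≡ , bs≡)
  ...   | inj₂ (t , as≡ , ds≡) = inj₂ (t , ≡.cong (x ∷_) as≡ , ds≡)

  ∷ʳ≢[] : ∀ xs (x : A) → xs ∷ʳ x ≢ []
  ∷ʳ≢[] xs x eq with ++-conicalʳ xs [ x ] eq
  ... | ()

  reverse-++-∷-∷ : ∀ pre (x y : A) suf →
    reverse (pre ++ x ∷ y ∷ suf) ≡ reverse suf ++ y ∷ x ∷ reverse pre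
  reverse-++-∷-∷ pre x y suf = ≡.trans (reverse-++ pre (x ∷ y ∷ suf))
    (≡.trans (≡.cong (_++ reverse pre) (reverse-++ (x ∷ y ∷ []) suf))
      (++-assoc (reverse suf) (y ∷ x ∷ []) (reverse pre)))

  map-≡-++-∷-∷⁻ : ∀ {b} {B : Set b} (f : A → B) xs pre x y suf → map f xs ≡ pre ++ x ∷ y ∷ suf →
    ∃[ pre′ ] ∃[ x′ ] ∃[ y′ ] ∃[ suf′ ] xs ≡ pre′ ++ x′ ∷ y′ ∷ suf′ × f x′ ≡ x × f y′ ≡ y
  map-≡-++-∷-∷⁻ f (x ∷ y ∷ xs) [] _ _ _ ≡.refl = [] , x , y , xs , ≡.refl , ≡.refl , ≡.refl
  map-≡-++-∷-∷⁻ f (z ∷ xs) (_ ∷ pre) x y suf eq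
    with map-≡-++-∷-∷⁻ f xs pre x y suf (proj₂ (∷-injective eq))
  ... | pre′ , x′ , y′ , suf′ , xs≡ , fx′ , fy′ =
    z ∷ pre′ , x′ , y′ , suf′ , ≡.cong (z ∷_) xs≡ , fx′ , fy′

  ++-∷-∷-as-rotation : ∀ pre (x y : A) suf → pre ++ x ∷ y ∷ suf ≡ (pre ∷ʳ x) ++ y ∷ suf
  ++-∷-∷-as-rotation pre x y suf = ≡.sym (++-assoc pre [ x ] (y ∷ suf))

  rotation-as-∷-∷ʳ : ∀ pre (x y : A) suf → (y ∷ suf) ++ (pre ∷ʳ x) ≡ y ∷ (suf ++ pre) ∷ʳ x
  rotation-as-∷-∷ʳ pre x y suf = ≡.cong (y ∷_) (≡.sym (++-assoc suf pre [ x ]))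

three-of-four-miss-one : ∀ (i j k : Fin 4) → i ≢ j → i ≢ k → j ≢ k →
  ∃[ m ] ∀ l → l ≢ m → l ∈ i ∷ j ∷ k ∷ []
three-of-four-miss-one = from-yes
  (all? λ i → all? λ j → all? λ k →
    ¬? (i ≟ j) →-dec ¬? (i ≟ k) →-dec ¬? (j ≟ k) →-dec
    any? λ m → all? λ l → ¬? (l ≟ m) →-dec l ∈? i ∷ j ∷ k ∷ [])

module Words {c ℓ} (Γ : Group c ℓ) where
  open Group Γ
  open GroupProperties Γ using (inverseˡ-unique; inverseʳ-unique; ⁻¹-involutive)
  open Cay Γ
  open import Relation.Binary.Reasoning.Setoid setoid

  prod-++ : ∀ xs ys → prod (xs ++ ys) ≈ prod xs ∙ prod ys
  prod-++ []       ys = sym (identityˡ _)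
  prod-++ (x ∷ xs) ys = trans (∙-congˡ (prod-++ xs ys)) (sym (assoc _ _ _))

  prod-≡ : ∀ {xs ys} → xs ≡ ys → prod xs ≈ prod ys
  prod-≡ eq = reflexive (≡.cong prod eq)

  x∙y≈ε⇒y∙x≈ε : ∀ {x y} → x ∙ y ≈ ε → y ∙ x ≈ ε
  x∙y≈ε⇒y∙x≈ε {x} {y} xy≈ε = trans (∙-congʳ (inverseʳ-unique x y xy≈ε)) (inverseˡ x)

  prod-rotate : ∀ xs ys → prod (xs ++ ys) ≈ ε → prod (ys ++ xs) ≈ ε
  prod-rotate xs ys eq = trans (prod-++ ys xs) (x∙y≈ε⇒y∙x≈ε (trans (sym (prod-++ xs ys)) eq))

  prod-conjugate≈ε : ∀ xs ms ys → prod (ys ++ xs) ≈ ε → prod (xs ++ ms ++ ys) ≈ ε → prod ms ≈ ε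
  prod-conjugate≈ε xs ms ys yx≈ε xmy≈ε = begin
    prod ms                   ≈⟨ sym (identityʳ _) ⟩
    prod ms ∙ ε               ≈⟨ ∙-congˡ yx≈ε ⟨
    prod ms ∙ prod (ys ++ xs) ≈⟨ prod-++ ms (ys ++ xs) ⟨
    prod (ms ++ ys ++ xs)     ≈⟨ prod-≡ (++-assoc ms ys xs) ⟨
    prod ((ms ++ ys) ++ xs)   ≈⟨ prod-rotate xs (ms ++ ys) xmy≈ε ⟩
    ε                         ∎

  occursIn-invWord : ∀ {x y} u → OccursIn x y (invWord u) → OccursIn (y ⁻¹) (x ⁻¹) u
  occursIn-invWord u (pre , a , b , suf , eq , a≈x , b≈y)
    with map-≡-++-∷-∷⁻ _⁻¹ u (reverse suf) b a (reverse pre)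
           (≡.trans (≡.sym (reverse-involutive (map _⁻¹ u)))
             (≡.trans (≡.cong reverse eq) (reverse-++-∷-∷ pre a b suf)))
  ... | pre′ , b′ , a′ , suf′ , u≡ , b′⁻¹≡b , a′⁻¹≡a =
    pre′ , b′ , a′ , suf′ , u≡ , from-⁻¹ b′⁻¹≡b b≈y , from-⁻¹ a′⁻¹≡a a≈x
    where
      from-⁻¹ : ∀ {z w t} → z ⁻¹ ≡ w → w ≈ t → z ≈ t ⁻¹
      from-⁻¹ {z} z⁻¹≡w w≈t = trans (sym (⁻¹-involutive z)) (⁻¹-cong (trans (reflexive z⁻¹≡w) w≈t))

  module _ {p} {S : Pred Carrier p} where

    morpheme-rotation-prefix≉ε : ∀ {xs ys} → IsMorpheme S (xs ++ ys) → xs ≢ [] → ys ≢ [] →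
      ∀ pre suf → ys ++ xs ≡ pre ++ suf → pre ≢ [] → suf ≢ [] → ¬ prod pre ≈ ε
    morpheme-rotation-prefix≉ε {xs} {ys} (_ , _ , xy≈ε , minimal) xs≢[] ys≢[]
                               pre suf eq pre≢[] suf≢[] pre≈ε
      with levi ys xs pre suf eq
    ... | inj₁ (t , ≡.refl , ≡.refl) =
      minimal t suf ys (++-assoc t suf ys) suf≢[] (inj₂ ys≢[])
        (prod-conjugate≈ε t suf ys pre≈ε (trans (prod-≡ (≡.sym (++-assoc t suf ys))) xy≈ε))
    ... | inj₂ (t , ≡.refl , ≡.refl) = minimal xs pre t ≡.refl pre≢[] (inj₁ xs≢[]) pre≈ε

    module Rotation {pre a b suf} (mor : IsMorpheme S (pre ++ a ∷ b ∷ suf)) where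

      closed : List Carrier
      closed = b ∷ (suf ++ pre) ∷ʳ a

      private
        split : IsMorpheme S ((pre ∷ʳ a) ++ b ∷ suf)
        split = ≡.subst (IsMorpheme S) (++-∷-∷-as-rotation pre a b suf) mor

      closed-in-S : S b × All S ((suf ++ pre) ∷ʳ a)
      closed-in-S with ++⁻ pre (proj₁ mor)
      ... | Spre , Sa ∷ Sb ∷ Ssuf = Sb , ++⁺ (++⁺ Ssuf Spre) (Sa ∷ [])

      prod-closed≈ε : prod closed ≈ ε
      prod-closed≈ε = trans (prod-≡ (≡.sym (rotation-as-∷-∷ʳ pre a b suf)))
        (prod-rotate (pre ∷ʳ a) (b ∷ suf) (proj₁ (proj₂ (proj₂ split))))

      length-closed : length closed ≡ length (pre ++ a ∷ b ∷ suf)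
      length-closed = ≡.trans (≡.cong length (≡.sym (rotation-as-∷-∷ʳ pre a b suf)))
        (≡.trans (length-++-comm (b ∷ suf) (pre ∷ʳ a))
          (≡.cong length (≡.sym (++-∷-∷-as-rotation pre a b suf))))

      arc≉ε : ∀ m m′ → suf ++ pre ≡ m ++ m′ → ¬ b ∙ prod m ≈ ε
      arc≉ε m m′ eq = morpheme-rotation-prefix≉ε split (∷ʳ≢[] pre a) (λ ()) (b ∷ m) (m′ ∷ʳ a)
        (≡.trans (rotation-as-∷-∷ʳ pre a b suf)
          (≡.cong (b ∷_) (≡.trans (≡.cong (_∷ʳ a) eq) (++-assoc m m′ [ a ]))))
        (λ ()) (∷ʳ≢[] m′ a)

      arc-end : b ∙ prod (suf ++ pre) ≈ a ⁻¹
      arc-end = inverseˡ-unique _ a (begin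
        (b ∙ prod (suf ++ pre)) ∙ a          ≈⟨ assoc _ _ _ ⟩
        b ∙ (prod (suf ++ pre) ∙ a)          ≈⟨ ∙-congˡ (∙-congˡ (identityʳ a)) ⟨
        b ∙ (prod (suf ++ pre) ∙ prod [ a ]) ≈⟨ ∙-congˡ (prod-++ (suf ++ pre) [ a ]) ⟨
        prod closed                          ≈⟨ prod-closed≈ε ⟩
        ε                                    ∎)

module LocalStructure {c ℓ p} (Γ : Group c ℓ) (S : Pred (Group.Carrier Γ) p)
                      (r : ℕ) (v : Group.Carrier Γ) where
  open Group Γ
  open GroupProperties Γ using (∙-cancelˡ; ⁻¹-involutive; x≈z//y)
  open Cay Γ
  open Words Γ
  open import Relation.Binary.Reasoning.Setoid setoid

  infix 4 _~_
  _~_ : Carrier → Carrier → Set (c ⊔ ℓ ⊔ p)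
  _~_ = Reach S r v

  Linked : Carrier → Carrier → Set (c ⊔ ℓ ⊔ p)
  Linked s t = v ∙ s ~ v ∙ t

  edgeOn-resp : ∀ {a a′ b b′ x y} (w : Walk S x y) → a′ ≈ a → b′ ≈ b → EdgeOn S a b w → EdgeOn S a′ b′ w
  edgeOn-resp ([] _) _ _ (lift ())
  edgeOn-resp (_ ∷ w) a′≈a b′≈b (inj₁ (inj₁ (a≈x , b≈y))) = inj₁ (inj₁ (trans a′≈a a≈x , trans b′≈b b≈y))
  edgeOn-resp (_ ∷ w) a′≈a b′≈b (inj₁ (inj₂ (a≈y , b≈x))) = inj₁ (inj₂ (trans a′≈a a≈y , trans b′≈b b≈x))
  edgeOn-resp (_ ∷ w) a′≈a b′≈b (inj₂ e) = inj₂ (edgeOn-resp w a′≈a b′≈b e)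

  edgeOn-sym : ∀ {a b x y} (w : Walk S x y) → EdgeOn S a b w → EdgeOn S b a w
  edgeOn-sym ([] _) (lift ())
  edgeOn-sym (_ ∷ w) (inj₁ (inj₁ (a≈x , b≈y))) = inj₁ (inj₂ (b≈y , a≈x))
  edgeOn-sym (_ ∷ w) (inj₁ (inj₂ (a≈y , b≈x))) = inj₁ (inj₁ (b≈x , a≈y))
  edgeOn-sym (_ ∷ w) (inj₂ e) = inj₂ (edgeOn-sym w e)

  punctEdge-resp : ∀ {a a′ b b′} → a′ ≈ a → b′ ≈ b → PunctEdge S r v a b → PunctEdge S r v a′ b′
  punctEdge-resp a′≈a b′≈b ((W , lW , e) , a≉v , b≉v) =
    (W , lW , edgeOn-resp W a′≈a b′≈b e) ,
    (λ a′≈v → a≉v (trans (sym a′≈a) a′≈v)) , (λ b′≈v → b≉v (trans (sym b′≈b) b′≈v))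

  punctEdge-sym : ∀ {a b} → PunctEdge S r v a b → PunctEdge S r v b a
  punctEdge-sym ((W , lW , e) , a≉v , b≉v) = (W , lW , edgeOn-sym W e) , b≉v , a≉v

  reach-respˡ : ∀ {a a′ b} → a′ ≈ a → a ~ b → a′ ~ b
  reach-respˡ a′≈a (here a≈b) = here (trans a′≈a a≈b)
  reach-respˡ a′≈a (step e a~b) = step (punctEdge-resp a′≈a refl e) a~b

  reach-trans : ∀ {a b d} → a ~ b → b ~ d → a ~ d
  reach-trans (here a≈b) b~d = reach-respˡ a≈b b~d
  reach-trans (step e a~b) b~d = step e (reach-trans a~b b~d)

  reach-sym : ∀ {a b} → a ~ b → b ~ a
  reach-sym (here a≈b) = here (sym a≈b)
  reach-sym (step e d~b) = reach-trans (reach-sym d~b) (step (punctEdge-sym e) (here refl))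

  reach-respʳ : ∀ {a b b′} → b′ ≈ b → a ~ b → a ~ b′
  reach-respʳ b′≈b a~b = reach-trans a~b (here (sym b′≈b))

  headOn : ∀ {x y} (w : Walk S x y) → VertexOn S x w
  headOn ([] _) = refl
  headOn (_ ∷ _) = inj₁ refl

  reach-along : ∀ {x y} (w : Walk S x y) →
    (∀ {a b} → EdgeOn S a b w → EdgeInBall S r v a b) → (∀ {a} → VertexOn S a w → ¬ a ≈ v) → x ~ y
  reach-along ([] x≈y) inBall avoids = here x≈y
  reach-along (_ ∷ w) inBall avoids =
    step (inBall (inj₁ (inj₁ (refl , refl))) , avoids (inj₁ refl) , avoids (inj₂ (headOn w)))
         (reach-along w (λ e → inBall (inj₂ e)) (λ on → avoids (inj₂ on)))

  wordWalk : ∀ z {y} w → All S w → y ≈ z ∙ prod w → Walk S z y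
  wordWalk z []      []        y≈z∙ε = [] (sym (trans y≈z∙ε (identityʳ z)))
  wordWalk z (s ∷ w) (Ss ∷ Sw) y≈z∙sw =
    (s , Ss , refl) ∷ wordWalk (z ∙ s) w Sw (trans y≈z∙sw (sym (assoc z s (prod w))))

  len-wordWalk : ∀ z {y} w Sw (e : y ≈ z ∙ prod w) → len S (wordWalk z w Sw e) ≡ length w
  len-wordWalk z []      []        e = ≡.refl
  len-wordWalk z (s ∷ w) (_ ∷ Sw) e = ≡.cong suc (len-wordWalk (z ∙ s) w Sw _)

  wordWalk-prefix : ∀ z {y y′} w t Sw Swt (e : y ≈ z ∙ prod w) (e′ : y′ ≈ z ∙ prod (w ++ t)) {a b} →
    EdgeOn S a b (wordWalk z w Sw e) → EdgeOn S a b (wordWalk z (w ++ t) Swt e′)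
  wordWalk-prefix z []      t []       _         _ _ (lift ())
  wordWalk-prefix z (s ∷ w) t (_ ∷ _)  (_ ∷ _)   _ _ (inj₁ first) = inj₁ first
  wordWalk-prefix z (s ∷ w) t (_ ∷ Sw) (_ ∷ Swt) _ _ (inj₂ later) =
    inj₂ (wordWalk-prefix (z ∙ s) w t Sw Swt _ _ later)

  wordWalk-vertex : ∀ z {y} w Sw (e : y ≈ z ∙ prod w) {a} → VertexOn S a (wordWalk z w Sw e) →
    ∃[ m ] ∃[ m′ ] w ≡ m ++ m′ × a ≈ z ∙ prod m
  wordWalk-vertex z []      []        e a≈z = [] , [] , ≡.refl , trans a≈z (sym (identityʳ z))
  wordWalk-vertex z (s ∷ w) (_ ∷ _)  e (inj₁ a≈z) = [] , s ∷ w , ≡.refl , trans a≈z (sym (identityʳ z))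
  wordWalk-vertex z (s ∷ w) (_ ∷ Sw) e (inj₂ on) with wordWalk-vertex (z ∙ s) w Sw _ on
  ... | m , m′ , w≡ , a≈zsm = s ∷ m , m′ , ≡.cong (s ∷_) w≡ , trans a≈zsm (assoc z s (prod m))

  morpheme-link : ∀ pre a b suf → IsMorpheme S (pre ++ a ∷ b ∷ suf) → length (pre ++ a ∷ b ∷ suf) ≤ r →
    Linked b (a ⁻¹)
  morpheme-link pre a b suf mor length≤r =
    reach-respʳ (trans (∙-congˡ (sym arc-end)) (sym (assoc v b _)))
      (reach-along arc arc-inBall arc-avoids)
    where
      open Rotation mor
      S-closed : All S closed
      S-closed = proj₁ closed-in-S ∷ proj₂ closed-in-S
      cycle : Walk S v v
      cycle = wordWalk v closed S-closed (sym (trans (∙-congˡ prod-closed≈ε) (identityʳ v)))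
      cycle≤r : len S cycle ≤ r
      cycle≤r = ≡.subst (_≤ r)
        (≡.sym (≡.trans (len-wordWalk v closed S-closed _) length-closed)) length≤r
      arc : Walk S (v ∙ b) ((v ∙ b) ∙ prod (suf ++ pre))
      arc = wordWalk (v ∙ b) (suf ++ pre) (++⁻ˡ (suf ++ pre) (proj₂ closed-in-S)) refl
      arc-inBall : ∀ {x y} → EdgeOn S x y arc → EdgeInBall S r v x y
      arc-inBall e = cycle , cycle≤r , inj₂ (wordWalk-prefix (v ∙ b) (suf ++ pre) [ a ] _ _ refl _ e)
      arc-avoids : ∀ {x} → VertexOn S x arc → ¬ x ≈ v
      arc-avoids {x} on x≈v with wordWalk-vertex (v ∙ b) (suf ++ pre) _ refl on
      ... | m , m′ , eq , x≈vbm = arc≉ε m m′ eq (∙-cancelˡ v _ ε (begin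
        v ∙ (b ∙ prod m) ≈⟨ assoc v b (prod m) ⟨
        (v ∙ b) ∙ prod m ≈⟨ x≈vbm ⟨
        x                ≈⟨ x≈v ⟩
        v                ≈⟨ identityʳ v ⟨
        v ∙ ε            ∎))

  occursIn-link : ∀ {x y u} → IsMorpheme S u → length u ≤ r → OccursIn x y u → Linked y (x ⁻¹)
  occursIn-link mor length≤r (pre , a , b , suf , ≡.refl , a≈x , b≈y) =
    reach-respˡ (∙-congˡ (sym b≈y)) (reach-respʳ (∙-congˡ (⁻¹-cong (sym a≈x)))
      (morpheme-link pre a b suf mor length≤r))

  contains-link : ∀ {x y u} → IsMorpheme S u → length u ≤ r → Contains x y u → Linked y (x ⁻¹)
  contains-link mor length≤r (inj₁ occ) = occursIn-link mor length≤r occ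
  contains-link {y = y} {u} mor length≤r (inj₂ occ) =
    reach-respˡ (∙-congˡ (sym (⁻¹-involutive y)))
      (reach-sym (occursIn-link mor length≤r (occursIn-invWord u occ)))

  module _ (g h : Carrier) where

    PatternLink : Fin 4 → Set (c ⊔ ℓ ⊔ p)
    PatternLink i = Linked (proj₂ (magicPattern g h i)) (proj₁ (magicPattern g h i) ⁻¹)

    h~g : PatternLink (suc (suc zero)) → Linked h g
    h~g = reach-respʳ (∙-congˡ (sym (⁻¹-involutive g)))

    via-h⁻¹ : PatternLink (suc zero) → PatternLink (suc (suc (suc zero))) → Linked g (g ⁻¹)
    via-h⁻¹ g~h⁻¹ g⁻¹~h⁻¹ = reach-trans g~h⁻¹ (reach-sym g⁻¹~h⁻¹)

    via-h : PatternLink zero → PatternLink (suc (suc zero)) → Linked g (g ⁻¹) × Linked g h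
    via-h h~g⁻¹ link₂ = reach-trans g~h h~g⁻¹ , g~h
      where
        g~h : Linked g h
        g~h = reach-sym (h~g link₂)

    -- Patterns 2, 0, 3, 1 link g, h, g⁻¹, h⁻¹ around a 4-cycle.
    cycle-minus-edge : ∀ m → (∀ i → i ≢ m → PatternLink i) → Linked g (g ⁻¹) × Linked g h
    cycle-minus-edge zero                   link =
      via-h⁻¹ (link (suc zero) λ ()) (link (suc (suc (suc zero))) λ ()) ,
      reach-sym (h~g (link (suc (suc zero)) λ ()))
    cycle-minus-edge (suc zero)             link = via-h (link zero λ ()) (link (suc (suc zero)) λ ())
    cycle-minus-edge (suc (suc zero))       link = g~g⁻¹ , reach-trans g~g⁻¹ (reach-sym (link zero λ ()))
      where
        g~g⁻¹ : Linked g (g ⁻¹)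
        g~g⁻¹ = via-h⁻¹ (link (suc zero) λ ()) (link (suc (suc (suc zero))) λ ())
    cycle-minus-edge (suc (suc (suc zero))) link = via-h (link zero λ ()) (link (suc (suc zero)) λ ())

    magic-link : ∀ {u} → IsMorpheme S u → length u ≤ r → IsMagic g h u → Linked g (g ⁻¹) × Linked g h
    magic-link {u} mor length≤r (i , j , k , i≢j , i≢k , j≢k , ci , cj , ck)
      with three-of-four-miss-one i j k i≢j i≢k j≢k
    ... | m , others = cycle-minus-edge m λ l l≢m →
      contains-link mor length≤r (lookup {P = λ l → ContainsPattern (magicPattern g h l) u}
        (ci ∷ cj ∷ ck ∷ []) (others l l≢m))

  HasMagicMorphemes : Set (c ⊔ ℓ ⊔ p)
  HasMagicMorphemes = ∀ g h → S g → S h → ¬ g ≡ᵍ h →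
    Σ (List Carrier) λ u → IsMorpheme S u × length u ≤ r × IsMagic g h u

  module _ (magic : HasMagicMorphemes) (S-inv : ∀ {s} → S s → S (s ⁻¹)) where

    inequivalent-linked : ∀ {g h} → S g → S h → ¬ g ≡ᵍ h → Linked g (g ⁻¹) × Linked g h
    inequivalent-linked {g} {h} Sg Sh g≢h with magic g h Sg Sh g≢h
    ... | u , mor , length≤r , magic-u = magic-link g h mor length≤r magic-u

    linked-to : ∀ {g₀ h₀ s} → S g₀ → S h₀ → ¬ g₀ ≡ᵍ h₀ → S s → ¬ ¬ Linked s g₀
    linked-to {g₀} {s = s} Sg₀ Sh₀ g₀≢h₀ Ss ¬linked = ¬¬-excluded-middle {A = s ≡ᵍ g₀} λ where
      (yes (inj₁ s≈g₀))   → ¬linked (here (∙-congˡ s≈g₀))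
      (yes (inj₂ s≈g₀⁻¹)) → ¬linked (reach-respˡ (∙-congˡ s≈g₀⁻¹)
                                       (reach-sym (proj₁ (inequivalent-linked Sg₀ Sh₀ g₀≢h₀))))
      (no s≢g₀)           → ¬linked (proj₂ (inequivalent-linked Ss Sg₀ s≢g₀))

    NearNeighbour : Carrier → Set (c ⊔ ℓ ⊔ p)
    NearNeighbour a = ∃[ s ] S s × a ~ v ∙ s

    -- Equality in Γ need not be decidable, so the first return of the walk to v
    -- is only found under double negation.
    walk-reaches-neighbour : ∀ {x} (w : Walk S x v) → (∀ {a b} → EdgeOn S a b w → EdgeInBall S r v a b) →
      ∀ {a} → VertexOn S a w → ¬ a ≈ v → ¬ ¬ NearNeighbour a
    walk-reaches-neighbour ([] x≈v) inBall a≈x a≉v _ = a≉v (trans a≈x x≈v)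
    walk-reaches-neighbour (_ ∷ w) inBall (inj₂ on) a≉v =
      walk-reaches-neighbour w (λ e → inBall (inj₂ e)) on a≉v
    walk-reaches-neighbour {x} (_∷_ {y = y} (s , Ss , y≈xs) w) inBall (inj₁ a≈x) a≉v ¬near =
      ¬¬-excluded-middle {A = y ≈ v} λ where
        (yes y≈v) → ¬near (s ⁻¹ , S-inv Ss ,
                            here (trans a≈x (trans (x≈z//y x s y (sym y≈xs)) (∙-congʳ y≈v))))
        (no y≉v)  → walk-reaches-neighbour w (λ e → inBall (inj₂ e)) (headOn w) y≉v λ (t , St , y~vt) →
          ¬near (t , St , step (inBall (inj₁ (inj₁ (a≈x , refl))) , a≉v , y≉v) y~vt)

    ball-reaches-neighbour : ∀ {a} → InBall S r v a → ¬ a ≈ v → ¬ ¬ NearNeighbour a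
    ball-reaches-neighbour (W , W≤r , on) = walk-reaches-neighbour W (λ e → W , W≤r , e) on

    no-local-cutvertex : Σ Carrier (λ g → Σ Carrier λ h → S g × S h × ¬ (g ≡ᵍ h)) → ¬ IsLocalCutvertex S r v
    no-local-cutvertex (g₀ , h₀ , Sg₀ , Sh₀ , g₀≢h₀) (a , b , (a∈ , a≉v) , (b∈ , b≉v) , a≁b) =
      ball-reaches-neighbour a∈ a≉v λ (s , Ss , a~vs) →
      ball-reaches-neighbour b∈ b≉v λ (t , St , b~vt) →
      linked-to Sg₀ Sh₀ g₀≢h₀ Ss λ s~g₀ →
      linked-to Sg₀ Sh₀ g₀≢h₀ St λ t~g₀ →
      a≁b (reach-trans a~vs (reach-trans s~g₀ (reach-trans (reach-sym t~g₀) (reach-sym b~vt))))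

lemma4p2 : ∀ {c ℓ p} (Γ : Group c ℓ) (S : Pred (Group.Carrier Γ) p) (n r : ℕ) →
    let open Group Γ using (Carrier) in
    let open Cay Γ in
    1 ≤ n → NilpotentClass≤ n → IsGeneratingSet S →
    Σ Carrier (λ g → Σ Carrier λ h → S g × S h × ¬ (g ≡ᵍ h)) →
    2 ^ suc n ≤ r →
    (∀ g h → S g → S h → ¬ (g ≡ᵍ h) →
      Σ (List Carrier) λ u → IsMorpheme S u × length u ≤ r × IsMagic g h u) →
    ∀ v → ¬ IsLocalCutvertex S r v
lemma4p2 Γ S n r _ _ (_ , _ , S-inv , _) inequivalent _ magic v =
  LocalStructure.no-local-cutvertex Γ S r v magic S-inv inequivalent
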